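{- Let $G$ be a normal triangle-free graph and let $\alpha(G)$ denote the size of a largest independent set of $G$. Then $G$ admits a star covering $(\mathbb{C},\mathbb{S})$ such that the graph $E[\mathbb{C}]$ consists of at most $\alpha(G)$ stars.
   Context: A graph $G$ is normal if there exist two coverings $\mathbb{C}$ and $\mathbb{S}$ of $V(G)$ such that every member of $\mathbb{C}$ induces a clique, every member of $\mathbb{S}$ induces an independent set, and $C \cap S \neq \emptyset$ for all $C \in \mathbb{C}$, $S \in \mathbb{S}$. A star covering of $G$ is a pair of coverings $\mathbb{C}$, $\mathbb{S}$ of $V(G)$ such that: (a) every member of $\mathbb{C}$ induces a clique $K_2$ or $K_1$ in $G$, and no $K_1$ member is contained in some $K_2$ member; (b) the graph on $V(G)$ whose edges are the $K_2$ members of $\mathbb{C}$, denoted $E[\mathbb{C}]$, is a spanning vertex-disjoint union of stars (an isolated vertex counting as a star consisting only of its center); (c) every member of $\mathbb{S}$ induces an independent set in $G$; (d) $C \cap S \neq \emptyset$ for every $C \in \mathbb{C}$ and $S \in \mathbb{S}$. -}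

module Defs where

open import Data.Nat using (ℕ; _≤_)
open import Data.Fin using (Fin)
open import Data.Fin.Subset using (Subset; _∈_; _∉_; _⊆_; ⁅_⁆; _∪_; ∣_∣)
open import Data.Bool using (Bool; true; false)
open import Data.List using (List)
open import Data.List.Relation.Unary.Any using (Any)
import Data.List.Membership.Propositional as LM
open import Data.Product using (Σ; ∃; ∃-syntax; _×_)
open import Data.Sum using (_⊎_)
open import Relation.Binary.PropositionalEquality using (_≡_; _≢_)
open import Relation.Nullary using (¬_)
open import Data.Empty using (⊥)

record Graph (n : ℕ) : Set where
  field
    adj    : Fin n → Fin n → Bool
    sym    : ∀ u v → adj u v ≡ adj v u
    irrefl : ∀ v → adj v v ≡ false

module _ {n : ℕ} (G : Graph n) where
  open Graph G

  Adj : Fin n → Fin n → Set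
  Adj u v = adj u v ≡ true

  IsClique : Subset n → Set
  IsClique S = ∀ u v → u ∈ S → v ∈ S → u ≢ v → Adj u v

  IsIndependent : Subset n → Set
  IsIndependent S = ∀ u v → u ∈ S → v ∈ S → ¬ Adj u v

  TriangleFree : Set
  TriangleFree = ∀ u v w → Adj u v → Adj v w → Adj u w → ⊥

  IsIndependenceNumber : ℕ → Set
  IsIndependenceNumber a =
    (∃[ I ] (IsIndependent I × ∣ I ∣ ≡ a)) × (∀ I → IsIndependent I → ∣ I ∣ ≤ a)

  Covers : List (Subset n) → Set
  Covers 𝓕 = ∀ v → Any (λ X → v ∈ X) 𝓕

  Meets : List (Subset n) → List (Subset n) → Set
  Meets 𝓒 𝓢 = ∀ C S → C LM.∈ 𝓒 → S LM.∈ 𝓢 → ∃[ v ] (v ∈ C × v ∈ S)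

  IsNormal : Set
  IsNormal = ∃[ 𝓒 ] ∃[ 𝓢 ]
    (Covers 𝓒 × Covers 𝓢
     × (∀ C → C LM.∈ 𝓒 → IsClique C)
     × (∀ S → S LM.∈ 𝓢 → IsIndependent S)
     × Meets 𝓒 𝓢)

  IsK1 : Subset n → Set
  IsK1 C = ∃[ v ] (C ≡ ⁅ v ⁆)

  IsK2 : Subset n → Set
  IsK2 C = ∃[ u ] ∃[ v ] (Adj u v × C ≡ ⁅ u ⁆ ∪ ⁅ v ⁆)

  EdgeOf : List (Subset n) → Fin n → Fin n → Set
  EdgeOf 𝓒 u v = Any (λ C → IsK2 C × u ∈ C × v ∈ C × u ≢ v) 𝓒

  -- H (symmetric relation on Fin n) is a spanning vertex-disjoint union of
  -- exactly k stars: Z is the set of star centres (an isolated vertex is a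
  -- centre), every edge joins a centre to a non-centre, and every
  -- non-centre (leaf) has exactly one neighbour.
  IsStarForestWith : (Fin n → Fin n → Set) → ℕ → Set
  IsStarForestWith H k = ∃[ Z ]
    ( ∣ Z ∣ ≡ k
    × (∀ u v → H u v → (u ∈ Z × v ∉ Z) ⊎ (u ∉ Z × v ∈ Z))
    × (∀ v → v ∉ Z → ∃[ w ] (H v w × (∀ w′ → H v w′ → w′ ≡ w))))

  IsStarCovering : List (Subset n) → List (Subset n) → Set
  IsStarCovering 𝓒 𝓢 =
      Covers 𝓒 × Covers 𝓢
    × (∀ C → C LM.∈ 𝓒 → IsK1 C ⊎ IsK2 C)
    × (∀ C D → C LM.∈ 𝓒 → D LM.∈ 𝓒 → IsK1 C → IsK2 D → ¬ (C ⊆ D))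
    × (∃[ k ] IsStarForestWith (EdgeOf 𝓒) k)
    × (∀ S → S LM.∈ 𝓢 → IsIndependent S)
    × Meets 𝓒 𝓢

-- Shrink the clique covering to an irredundant one: every member then has a
-- private vertex, lying in no other member.  Triangle-freeness makes every
-- member a K1 or a K2, a K1 cannot sit inside another member because its
-- vertex is private, and every edge of E[C] has a private, hence pendant,
-- endpoint, so E[C] is a star forest.  Every member of C meets a fixed
-- independent set S, so S dominates E[C]; distinct star centres are dominated
-- by distinct vertices of S, whence the number of stars is at most |S| ≤ α(G).
module Submission where

open import Defs
open import Data.Nat using (ℕ; _≤_)
open import Data.Product using (∃-syntax; _×_)

open import Data.Nat using (zero; suc; z≤n; s≤s)
open import Data.Product using (_,_; proj₁)
import Data.Nat as ℕ
open import Data.Nat.Properties using (≤-trans; module ≤-Reasoning)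
open import Data.Nat.Induction using (<-wellFounded)
open import Induction.WellFounded using (Acc; acc)
open import Data.Bool using (true)
import Data.Bool as Bool
open import Data.Fin using (Fin; zero; suc; _<_; fromℕ<)
open import Data.Fin.Properties using (_≟_; _<?_; any?; all?; ¬∀⟶∃¬; <-cmp; <-asym)
open import Data.Fin.Subset
  using (Subset; inside; outside; _∈_; _∉_; _⊆_; _-_; ⁅_⁆; _∪_; ∣_∣; Nonempty)
open import Data.Fin.Subset.Properties
  using ( _∈?_; nonempty?; Empty-unique; ∣⊥∣≡0; ∣p∣≤n; p─⊥≡p; p─q⊆p
        ; x∈p⇒∣p-x∣<∣p∣; x∈p∧x≢y⇒x∈p-y; x∈⁅x⁆; x∈⁅y⁆⇒x≡y; x∈p∪q⁺; x∈p∪q⁻; ⊆-antisym)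
open import Data.Vec using (_∷_; here; there; tabulate)
open import Data.Vec.Properties using (≡-dec; lookup∘tabulate; lookup⇒[]=; []=⇒lookup)
open import Data.List using (List; []; _∷_; _++_)
open import Data.List.Properties using (++-identityʳ)
open import Data.List.Relation.Unary.Any using (Any; here; there)
import Data.List.Relation.Unary.Any as Any
open import Data.List.Membership.Propositional using (find; lose) renaming (_∈_ to _∈ᴸ_)
open import Data.List.Relation.Binary.Subset.Propositional using () renaming (_⊆_ to _⊆ᴸ_)
open import Data.List.Relation.Binary.Subset.Propositional.Properties
  using (⊆-refl; ⊆-trans; ⊆-reflexive-↭; Any-resp-⊆; xs⊆x∷xs; ++⁺ʳ)
open import Data.List.Relation.Binary.Permutation.Propositional using (↭-sym)
open import Data.List.Relation.Binary.Permutation.Propositional.Properties using (shift)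
open import Data.Sum using (_⊎_; inj₁; inj₂; [_,_]′; swap)
import Data.Sum as Sum
open import Data.Empty using (⊥; ⊥-elim)
open import Function using (_∘_; id)
open import Relation.Binary.PropositionalEquality
  using (_≡_; _≢_; refl; sym; trans; cong; subst)
open import Relation.Binary.Definitions using (tri<; tri≈; tri>)
open import Relation.Nullary using (¬_; Dec; yes; no; does)
open import Relation.Nullary.Decidable using (_×-dec_; _→-dec_; ¬?; dec-true; decidable-stable)
open import Relation.Unary using (Decidable)

∣p∣≡1+∣p-x∣ : ∀ {n} {x : Fin n} {p : Subset n} → x ∈ p → ∣ p ∣ ≡ suc ∣ p - x ∣
∣p∣≡1+∣p-x∣ {p = inside ∷ p}  here        = cong (suc ∘ ∣_∣) (sym (p─⊥≡p p))
∣p∣≡1+∣p-x∣ {p = inside ∷ p}  (there x∈p) = cong suc (∣p∣≡1+∣p-x∣ x∈p)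
∣p∣≡1+∣p-x∣ {p = outside ∷ p} (there x∈p) = ∣p∣≡1+∣p-x∣ x∈p

x∉p-x : ∀ {n} {x : Fin n} (p : Subset n) → x ∉ p - x
x∉p-x {x = zero}  (_ ∷ p) ()
x∉p-x {x = suc x} (_ ∷ p) (there x∈p-x) = x∉p-x p x∈p-x

x∈p-y⇒x≢y : ∀ {n} {x y : Fin n} {p : Subset n} → x ∈ p - y → x ≢ y
x∈p-y⇒x≢y {p = p} x∈p-y refl = x∉p-x p x∈p-y

module _ {n : ℕ} (R : Fin n → Fin n → Set) where

  injection⇒∣p∣≤∣q∣ : ∀ {p q : Subset n} →
    (∀ {z} → z ∈ p → ∃[ s ] (s ∈ q × R z s)) →
    (∀ {z₁ z₂ s} → z₁ ∈ p → z₂ ∈ p → R z₁ s → R z₂ s → z₁ ≡ z₂) →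
    ∣ p ∣ ≤ ∣ q ∣
  injection⇒∣p∣≤∣q∣ = go (<-wellFounded _)
    where
    go : ∀ {p q : Subset n} → Acc ℕ._<_ ∣ p ∣ →
      (∀ {z} → z ∈ p → ∃[ s ] (s ∈ q × R z s)) →
      (∀ {z₁ z₂ s} → z₁ ∈ p → z₂ ∈ p → R z₁ s → R z₂ s → z₁ ≡ z₂) →
      ∣ p ∣ ≤ ∣ q ∣
    go {p} {q} (acc smaller) image injective with nonempty? p
    ... | no p-empty =
      subst (_≤ ∣ q ∣) (sym (trans (cong ∣_∣ (Empty-unique p-empty)) (∣⊥∣≡0 n))) z≤n
    ... | yes (z , z∈p) with image z∈p
    ... | s , s∈q , Rzs = begin
      ∣ p ∣          ≡⟨ ∣p∣≡1+∣p-x∣ z∈p ⟩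
      suc ∣ p - z ∣  ≤⟨ s≤s (go (smaller (x∈p⇒∣p-x∣<∣p∣ z∈p)) image′ injective′) ⟩
      suc ∣ q - s ∣  ≡⟨ sym (∣p∣≡1+∣p-x∣ s∈q) ⟩
      ∣ q ∣          ∎
      where
      open ≤-Reasoning
      ⊆p : ∀ {y} → y ∈ p - z → y ∈ p
      ⊆p = p─q⊆p p ⁅ z ⁆
      image′ : ∀ {y} → y ∈ p - z → ∃[ t ] (t ∈ q - s × R y t)
      image′ y∈ with image (⊆p y∈)
      ... | t , t∈q , Ryt = t , x∈p∧x≢y⇒x∈p-y t∈q t≢s , Ryt
        where
        t≢s : t ≢ s
        t≢s refl = x∈p-y⇒x≢y y∈ (injective (⊆p y∈) z∈p Ryt Rzs)
      injective′ : ∀ {z₁ z₂ t} → z₁ ∈ p - z → z₂ ∈ p - z → R z₁ t → R z₂ t → z₁ ≡ z₂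
      injective′ z₁∈ z₂∈ = injective (⊆p z₁∈) (⊆p z₂∈)

select : ∀ {n} {P : Fin n → Set} → Decidable P → Subset n
select P? = tabulate (does ∘ P?)

module _ {n} {P : Fin n → Set} (P? : Decidable P) where

  ∈select⁺ : ∀ {x} → P x → x ∈ select P?
  ∈select⁺ {x} px = lookup⇒[]= x _ (trans (lookup∘tabulate _ x) (dec-true (P? x) px))

  ∈select⁻ : ∀ {x} → x ∈ select P? → P x
  ∈select⁻ {x} x∈ with P? x | trans (sym (lookup∘tabulate (does ∘ P?) x)) ([]=⇒lookup x∈)
  ... | yes px | _  = px
  ... | no _   | ()

∈-pair⁺ : ∀ {n} {t a b : Fin n} → t ≡ a ⊎ t ≡ b → t ∈ ⁅ a ⁆ ∪ ⁅ b ⁆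
∈-pair⁺ (inj₁ refl) = x∈p∪q⁺ (inj₁ (x∈⁅x⁆ _))
∈-pair⁺ (inj₂ refl) = x∈p∪q⁺ (inj₂ (x∈⁅x⁆ _))

∈-pair⁻ : ∀ {n} {t a b : Fin n} → t ∈ ⁅ a ⁆ ∪ ⁅ b ⁆ → t ≡ a ⊎ t ≡ b
∈-pair⁻ {a = a} {b} t∈ = Sum.map (x∈⁅y⁆⇒x≡y a) (x∈⁅y⁆⇒x≡y b) (x∈p∪q⁻ ⁅ a ⁆ ⁅ b ⁆ t∈)

Private : ∀ {n} → List (Subset n) → Subset n → Set
Private 𝓛 X = ∃[ v ] (v ∈ X × ∀ {Y} → Y ∈ᴸ 𝓛 → v ∈ Y → Y ≡ X)

Irredundant : ∀ {n} → List (Subset n) → Set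
Irredundant 𝓛 = ∀ {X} → X ∈ᴸ 𝓛 → Private 𝓛 X

Private-antitone : ∀ {n} {𝓛 𝓜 : List (Subset n)} {X} → 𝓛 ⊆ᴸ 𝓜 → Private 𝓜 X → Private 𝓛 X
Private-antitone 𝓛⊆𝓜 (v , v∈X , only-X) = v , v∈X , λ Y∈ v∈Y → only-X (𝓛⊆𝓜 Y∈) v∈Y

uncovered⇒Private : ∀ {n} {𝓛 : List (Subset n)} {X v} →
  v ∈ X → ¬ Any (v ∈_) 𝓛 → Private (X ∷ 𝓛) X
uncovered⇒Private v∈X v∉⋃𝓛 = _ , v∈X , λ
  { (here Y≡X)  _   → Y≡X
  ; (there Y∈) v∈Y → ⊥-elim (v∉⋃𝓛 (lose Y∈ v∈Y)) }

module _ {n : ℕ} (G : Graph n) where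

  covers? : (𝓛 : List (Subset n)) → Dec (Covers G 𝓛)
  covers? 𝓛 = all? (λ v → Any.any? (v ∈?_) 𝓛)

  Covers-mono : ∀ {𝓛 𝓜} → 𝓛 ⊆ᴸ 𝓜 → Covers G 𝓛 → Covers G 𝓜
  Covers-mono 𝓛⊆𝓜 cover v = Any-resp-⊆ 𝓛⊆𝓜 (cover v)

  IrredundantSubcover : List (Subset n) → Set
  IrredundantSubcover 𝓛 = ∃[ 𝓡 ] (𝓡 ⊆ᴸ 𝓛 × Covers G 𝓡 × Irredundant 𝓡)

  IrredundantSubcover-mono : ∀ {𝓛 𝓜} → 𝓛 ⊆ᴸ 𝓜 → IrredundantSubcover 𝓛 → IrredundantSubcover 𝓜
  IrredundantSubcover-mono 𝓛⊆𝓜 (𝓡 , 𝓡⊆𝓛 , cover , irredundant) =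
    𝓡 , ⊆-trans 𝓡⊆𝓛 𝓛⊆𝓜 , cover , irredundant

  -- A member that cannot be dropped covers some vertex alone, which becomes
  -- its private vertex.
  prune : ∀ kept rest → Covers G (kept ++ rest) →
    (∀ {X} → X ∈ᴸ kept → Private (kept ++ rest) X) →
    IrredundantSubcover (kept ++ rest)
  prune kept [] rewrite ++-identityʳ kept = λ cover privates → kept , ⊆-refl , cover , privates
  prune kept (X ∷ rest) cover privates with covers? (kept ++ rest)
  ... | yes cover′ =
    IrredundantSubcover-mono dropX (prune kept rest cover′ (Private-antitone dropX ∘ privates))
    where
    dropX : kept ++ rest ⊆ᴸ kept ++ X ∷ rest
    dropX = ++⁺ʳ kept (xs⊆x∷xs rest X)
  ... | no ¬cover′ with ¬∀⟶∃¬ n _ (λ v → Any.any? (v ∈?_) (kept ++ rest)) ¬cover′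
  ... | v , v-uncovered =
    IrredundantSubcover-mono from-front (prune (X ∷ kept) rest (Covers-mono to-front cover) privates′)
    where
    to-front : kept ++ X ∷ rest ⊆ᴸ X ∷ kept ++ rest
    to-front = ⊆-reflexive-↭ (shift X kept rest)
    from-front : X ∷ kept ++ rest ⊆ᴸ kept ++ X ∷ rest
    from-front = ⊆-reflexive-↭ (↭-sym (shift X kept rest))
    privates′ : ∀ {Y} → Y ∈ᴸ X ∷ kept → Private (X ∷ kept ++ rest) Y
    privates′ (here refl) =
      uncovered⇒Private (Any.head v-uncovered (Covers-mono to-front cover v)) v-uncovered
    privates′ (there Y∈) = Private-antitone from-front (privates Y∈)

  irredundant-subcover : ∀ {𝓒} → Covers G 𝓒 → IrredundantSubcover 𝓒
  irredundant-subcover {𝓒} cover = prune [] 𝓒 cover (λ ())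

SoleNeighbour : ∀ {n} → (Fin n → Fin n → Set) → Fin n → Fin n → Set
SoleNeighbour H x w = H x w × (∀ w′ → H x w′ → w′ ≡ w)

Dominates : ∀ {n} → (Fin n → Fin n → Set) → Subset n → Set
Dominates H S = ∀ v → ∃[ s ] (s ∈ S × (s ≡ v ⊎ H s v))

module _ {n : ℕ} (G : Graph n) (H : Fin n → Fin n → Set) where

  star-forest⇒vertex : ∀ {k} → IsStarForestWith G H (suc k) → Fin n
  star-forest⇒vertex (Z , ∣Z∣≡1+k , _) =
    fromℕ< (≤-trans (s≤s z≤n) (subst (_≤ n) ∣Z∣≡1+k (∣p∣≤n Z)))

  stars≤dominating : ∀ {k S} → IsStarForestWith G H k → Dominates H S → k ≤ ∣ S ∣
  stars≤dominating (Z , refl , bipartite , sole) dominates =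
    injection⇒∣p∣≤∣q∣ (λ z s → s ≡ z ⊎ H s z) (λ {z} _ → dominates z) injective
    where
    ¬centre-edge : ∀ {u v} → u ∈ Z → v ∈ Z → ¬ H u v
    ¬centre-edge u∈ v∈ uv = [ (λ (_ , v∉) → v∉ v∈) , (λ (u∉ , _) → u∉ u∈) ]′ (bipartite _ _ uv)
    injective : ∀ {z₁ z₂ s} → z₁ ∈ Z → z₂ ∈ Z → s ≡ z₁ ⊎ H s z₁ → s ≡ z₂ ⊎ H s z₂ → z₁ ≡ z₂
    injective _   _   (inj₁ refl) (inj₁ refl) = refl
    injective z₁∈ z₂∈ (inj₁ refl) (inj₂ sz₂)  = ⊥-elim (¬centre-edge z₁∈ z₂∈ sz₂)
    injective z₁∈ z₂∈ (inj₂ sz₁)  (inj₁ refl) = ⊥-elim (¬centre-edge z₂∈ z₁∈ sz₁)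
    injective {s = s} z₁∈ _ (inj₂ sz₁) (inj₂ sz₂) with bipartite _ _ sz₁
    ... | inj₁ (_ , z₁∉) = ⊥-elim (z₁∉ z₁∈)
    ... | inj₂ (s∉ , _) with sole s s∉
    ... | w , _ , only-w = trans (only-w _ sz₁) (sym (only-w _ sz₂))

  module _ (H? : ∀ u v → Dec (H u v))
           (H-sym : ∀ {u v} → H u v → H v u)
           (H-irrefl : ∀ {u v} → H u v → u ≢ v)
           (pendant : ∀ {u v} → H u v → SoleNeighbour H u v ⊎ SoleNeighbour H v u) where

    SoleNeighbour? : ∀ x w → Dec (SoleNeighbour H x w)
    SoleNeighbour? x w = H? x w ×-dec all? (λ w′ → H? x w′ →-dec w′ ≟ w)

    -- An edge whose endpoints are both pendant is a K2 component; its larger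
    -- endpoint is declared the leaf.
    Leaf : Fin n → Set
    Leaf x = ∃[ w ] (SoleNeighbour H x w × (SoleNeighbour H w x → w < x))

    Leaf? : ∀ x → Dec (Leaf x)
    Leaf? x = any? λ w → SoleNeighbour? x w ×-dec (SoleNeighbour? w x →-dec w <? x)

    ¬Leaf×Leaf : ∀ {u v} → H u v → Leaf u → Leaf v → ⊥
    ¬Leaf×Leaf uv (_ , (_ , only-u) , tie-u) (_ , (_ , only-v) , tie-v)
      with only-u _ uv | only-v _ (H-sym uv)
    ... | refl | refl = <-asym (tie-v (uv , only-u)) (tie-u (H-sym uv , only-v))

    SoleNeighbour⇒Leaf⊎Leaf : ∀ {u v} → SoleNeighbour H u v → Leaf u ⊎ Leaf v
    SoleNeighbour⇒Leaf⊎Leaf {u} {v} u→v with SoleNeighbour? v u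
    ... | no ¬v→u = inj₁ (v , u→v , ⊥-elim ∘ ¬v→u)
    ... | yes v→u with <-cmp u v
    ...   | tri< u<v _ _ = inj₂ (u , v→u , λ _ → u<v)
    ...   | tri≈ _ u≡v _ = ⊥-elim (H-irrefl (proj₁ u→v) u≡v)
    ...   | tri> _ _ v<u = inj₁ (v , u→v , λ _ → v<u)

    edge⇒Leaf⊎Leaf : ∀ {u v} → H u v → Leaf u ⊎ Leaf v
    edge⇒Leaf⊎Leaf uv =
      [ SoleNeighbour⇒Leaf⊎Leaf , swap ∘ SoleNeighbour⇒Leaf⊎Leaf ]′ (pendant uv)

    pendant-edges⇒star-forest : ∃[ k ] IsStarForestWith G H k
    pendant-edges⇒star-forest = ∣ Z ∣ , Z , refl , bipartite , leaf-sole
      where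
      Z : Subset n
      Z = select (¬? ∘ Leaf?)
      Leaf⇒∉Z : ∀ {x} → Leaf x → x ∉ Z
      Leaf⇒∉Z leaf x∈Z = ∈select⁻ (¬? ∘ Leaf?) x∈Z leaf
      bipartite : ∀ u v → H u v → (u ∈ Z × v ∉ Z) ⊎ (u ∉ Z × v ∈ Z)
      bipartite u v uv with edge⇒Leaf⊎Leaf uv
      ... | inj₁ leaf-u = inj₂ (Leaf⇒∉Z leaf-u , ∈select⁺ (¬? ∘ Leaf?) (¬Leaf×Leaf uv leaf-u))
      ... | inj₂ leaf-v =
        inj₁ (∈select⁺ (¬? ∘ Leaf?) (λ leaf-u → ¬Leaf×Leaf uv leaf-u leaf-v) , Leaf⇒∉Z leaf-v)
      leaf-sole : ∀ v → v ∉ Z → ∃[ w ] SoleNeighbour H v w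
      leaf-sole v v∉Z with decidable-stable (Leaf? v) (v∉Z ∘ ∈select⁺ (¬? ∘ Leaf?))
      ... | w , sole , _ = w , sole

module _ {n : ℕ} (G : Graph n) where
  open Graph G using (adj; irrefl)

  ¬Adj-refl : ∀ {v} → ¬ Adj G v v
  ¬Adj-refl {v} v~v with trans (sym v~v) (irrefl v)
  ... | ()

  ¬K1×K2 : ∀ {C} → IsK1 G C → IsK2 G C → ⊥
  ¬K1×K2 (v , refl) (a , b , a~b , ⁅v⁆≡⁅a⁆∪⁅b⁆)
    with x∈⁅y⁆⇒x≡y v (subst (a ∈_) (sym ⁅v⁆≡⁅a⁆∪⁅b⁆) (∈-pair⁺ (inj₁ refl)))
       | x∈⁅y⁆⇒x≡y v (subst (b ∈_) (sym ⁅v⁆≡⁅a⁆∪⁅b⁆) (∈-pair⁺ (inj₂ refl)))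
  ... | refl | refl = ¬Adj-refl a~b

  K1⊈K2 : ∀ {𝓡} → Irredundant 𝓡 →
    ∀ C D → C ∈ᴸ 𝓡 → D ∈ᴸ 𝓡 → IsK1 G C → IsK2 G D → ¬ (C ⊆ D)
  K1⊈K2 irredundant C D C∈ D∈ k1 k2 C⊆D with irredundant C∈
  ... | p , p∈C , only-C with only-C D∈ (C⊆D p∈C)
  ... | refl = ¬K1×K2 k1 k2

  distinct-members⇒K2 : ∀ {X s v} → IsK1 G X ⊎ IsK2 G X → s ∈ X → v ∈ X → s ≢ v → IsK2 G X
  distinct-members⇒K2 (inj₁ (w , refl)) s∈ v∈ s≢v =
    ⊥-elim (s≢v (trans (x∈⁅y⁆⇒x≡y w s∈) (sym (x∈⁅y⁆⇒x≡y w v∈))))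
  distinct-members⇒K2 (inj₂ k2) _ _ _ = k2

  IsK2? : ∀ C → Dec (IsK2 G C)
  IsK2? C = any? λ a → any? λ b → (adj a b Bool.≟ true) ×-dec ≡-dec Bool._≟_ C (⁅ a ⁆ ∪ ⁅ b ⁆)

  module _ (𝓡 : List (Subset n)) where

    EdgeOf? : ∀ u v → Dec (EdgeOf G 𝓡 u v)
    EdgeOf? u v = Any.any? (λ C → IsK2? C ×-dec (u ∈? C) ×-dec (v ∈? C) ×-dec ¬? (u ≟ v)) 𝓡

    EdgeOf-sym : ∀ {u v} → EdgeOf G 𝓡 u v → EdgeOf G 𝓡 v u
    EdgeOf-sym = Any.map λ { (k2 , u∈ , v∈ , u≢v) → k2 , v∈ , u∈ , u≢v ∘ sym }

    EdgeOf-irrefl : ∀ {u v} → EdgeOf G 𝓡 u v → u ≢ v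
    EdgeOf-irrefl uv with find uv
    ... | _ , _ , _ , _ , _ , u≢v = u≢v

  module _ (triangle-free : TriangleFree G) where

    clique-member-≡ : ∀ {X u v w} → IsClique G X → u ∈ X → v ∈ X → u ≢ v → w ∈ X → w ≡ u ⊎ w ≡ v
    clique-member-≡ {u = u} {v} {w} clique u∈ v∈ u≢v w∈ with w ≟ u | w ≟ v
    ... | yes w≡u | _       = inj₁ w≡u
    ... | no _    | yes w≡v = inj₂ w≡v
    ... | no w≢u  | no w≢v  = ⊥-elim (triangle-free _ _ _
      (clique _ _ u∈ v∈ u≢v) (clique _ _ v∈ w∈ (w≢v ∘ sym)) (clique _ _ u∈ w∈ (w≢u ∘ sym)))

    clique⇒K1⊎K2 : ∀ {X} → IsClique G X → Nonempty X → IsK1 G X ⊎ IsK2 G X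
    clique⇒K1⊎K2 {X} clique (v , v∈X) with any? (λ u → (u ∈? X) ×-dec ¬? (u ≟ v))
    ... | no ∄other = inj₁ (v , ⊆-antisym X⊆⁅v⁆ (λ w∈⁅v⁆ → subst (_∈ X) (sym (x∈⁅y⁆⇒x≡y v w∈⁅v⁆)) v∈X))
      where
      X⊆⁅v⁆ : X ⊆ ⁅ v ⁆
      X⊆⁅v⁆ {w} w∈X with w ≟ v
      ... | yes refl = x∈⁅x⁆ v
      ... | no w≢v   = ⊥-elim (∄other (w , w∈X , w≢v))
    ... | yes (u , u∈X , u≢v) = inj₂ (v , u , clique v u v∈X u∈X (u≢v ∘ sym) , ⊆-antisym
      (∈-pair⁺ ∘ clique-member-≡ clique v∈X u∈X (u≢v ∘ sym))
      (λ w∈ → [ (λ { refl → v∈X }) , (λ { refl → u∈X }) ]′ (∈-pair⁻ w∈)))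

    module _ {𝓡 : List (Subset n)} (cliques : ∀ {X} → X ∈ᴸ 𝓡 → IsClique G X)
             (irredundant : Irredundant 𝓡) where

      private-vertex⇒sole-neighbour : ∀ {Y p v} → p ∈ Y → v ∈ Y → p ≢ v →
        (∀ {Y′} → Y′ ∈ᴸ 𝓡 → p ∈ Y′ → Y′ ≡ Y) → ∀ w → EdgeOf G 𝓡 p w → w ≡ v
      private-vertex⇒sole-neighbour p∈ v∈ p≢v only-Y w pw with find pw
      ... | Y′ , Y′∈ , _ , p∈′ , w∈′ , p≢w with only-Y Y′∈ p∈′
      ... | refl = [ (λ w≡p → ⊥-elim (p≢w (sym w≡p))) , id ]′
                     (clique-member-≡ (cliques Y′∈) p∈ v∈ p≢v w∈′)

      EdgeOf-pendant : ∀ {u v} → EdgeOf G 𝓡 u v →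
        SoleNeighbour (EdgeOf G 𝓡) u v ⊎ SoleNeighbour (EdgeOf G 𝓡) v u
      EdgeOf-pendant uv with find uv
      ... | Y , Y∈ , _ , u∈ , v∈ , u≢v with irredundant Y∈
      ... | p , p∈Y , only-Y with clique-member-≡ (cliques Y∈) u∈ v∈ u≢v p∈Y
      ... | inj₁ refl = inj₁ (uv , private-vertex⇒sole-neighbour u∈ v∈ u≢v only-Y)
      ... | inj₂ refl = inj₂ (EdgeOf-sym 𝓡 uv , private-vertex⇒sole-neighbour v∈ u∈ (u≢v ∘ sym) only-Y)

  meets⇒Dominates : ∀ {𝓡 S} → Covers G 𝓡 → (∀ {X} → X ∈ᴸ 𝓡 → IsK1 G X ⊎ IsK2 G X) →
    (∀ {X} → X ∈ᴸ 𝓡 → ∃[ s ] (s ∈ X × s ∈ S)) → Dominates (EdgeOf G 𝓡) S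
  meets⇒Dominates cover K1⊎K2 meets v with find (cover v)
  ... | X , X∈ , v∈X with meets X∈
  ... | s , s∈X , s∈S with s ≟ v
  ... | yes s≡v = s , s∈S , inj₁ s≡v
  ... | no s≢v  = s , s∈S ,
    inj₂ (lose X∈ (distinct-members⇒K2 (K1⊎K2 X∈) s∈X v∈X s≢v , s∈X , v∈X , s≢v))

claim1 : ∀ {n} (G : Graph n) → IsNormal G → TriangleFree G →
    ∀ a → IsIndependenceNumber G a →
    ∃[ 𝓒 ] ∃[ 𝓢 ] (IsStarCovering G 𝓒 𝓢 × ∃[ k ] (IsStarForestWith G (EdgeOf G 𝓒) k × k ≤ a))
claim1 G (𝓒 , 𝓢 , cover𝓒 , cover𝓢 , cliques , independent , meets) triangle-free a (_ , α-max)
  with irredundant-subcover G cover𝓒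
... | 𝓡 , 𝓡⊆𝓒 , cover𝓡 , irredundant =
  let k , forest = pendant-edges⇒star-forest G (EdgeOf G 𝓡) (EdgeOf? G 𝓡)
                     (EdgeOf-sym G 𝓡) (EdgeOf-irrefl G 𝓡)
                     (EdgeOf-pendant G triangle-free cliques𝓡 irredundant)
  in 𝓡 , 𝓢 ,
     (cover𝓡 , cover𝓢 , (λ _ → K1⊎K2) , K1⊈K2 G irredundant , (k , forest) , independent , meets𝓡) ,
     k , forest , stars≤α forest
  where
  cliques𝓡 : ∀ {X} → X ∈ᴸ 𝓡 → IsClique G X
  cliques𝓡 X∈ = cliques _ (𝓡⊆𝓒 X∈)
  K1⊎K2 : ∀ {X} → X ∈ᴸ 𝓡 → IsK1 G X ⊎ IsK2 G X
  K1⊎K2 X∈ with irredundant X∈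
  ... | v , v∈X , _ = clique⇒K1⊎K2 G triangle-free (cliques𝓡 X∈) (v , v∈X)
  meets𝓡 : Meets G 𝓡 𝓢
  meets𝓡 C S C∈ = meets C S (𝓡⊆𝓒 C∈)
  stars≤α : ∀ {k} → IsStarForestWith G (EdgeOf G 𝓡) k → k ≤ a
  stars≤α {zero}  _      = z≤n
  stars≤α {suc _} forest with find (cover𝓢 (star-forest⇒vertex G _ forest))
  ... | S , S∈ , _ = ≤-trans
    (stars≤dominating G _ forest (meets⇒Dominates G cover𝓡 K1⊎K2 (λ X∈ → meets𝓡 _ S X∈ S∈)))
    (α-max S (independent S S∈))
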